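{- Consider the $(\mathbf{s},\mathbf{k},t)$ asymmetric document exchange problem (Bob holds the vector of subsets $\mathcal{S}=(S_1,\dots,S_t)$), let $k=\sum_{i=1}^t k_i$, and suppose the goal is for Alice to learn Bob's string. Then every deterministic protocol has communication complexity at least $\mathsf{H}(n,k)$, and every randomized protocol with success probability at least $1/2$ has communication complexity at least $\mathsf{H}(n,k)-1$. This holds even if Alice knows $\mathbf{s}$ and $\mathbf{k}$.
   Context: The $(\mathbf{s},\mathbf{k},t)$ asymmetric document exchange problem: Alice holds $x\in\{0,1\}^n$ and Bob holds $y\in\{0,1\}^n$. Both parties know $t$, $\mathbf{s}=(s_1,\dots,s_t)$ and $\mathbf{k}=(k_1,\dots,k_t)$. Bob additionally knows a vector of pairwise disjoint subsets $\mathcal{S}=(S_1,\dots,S_t)$, $S_i\subseteq[n]$, $|S_i|=s_i$, such that for each $i$ the number of positions $j\in S_i$ with $x_j\neq y_j$ is at most $k_i$. A protocol must succeed for every such $\mathcal{S}$ and every pair $x,y$ consistent with $\mathcal{S}$ and $\mathbf{k}$ (randomized protocols use shared randomness and must succeed with the stated probability on every such input). For integers $s\ge k$, $\mathsf{H}(s,k)=\log\left(\sum_{j=0}^{k}\binom{s}{j}\right)$ (logarithm base 2). Communication complexity is the total number of bits exchanged. -}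

module Defs where

open import Data.Bool using (Bool; _xor_)
import Data.Bool as Bool
open import Data.Nat using (ℕ; zero; suc; _+_; _≤_)
open import Data.Nat.Combinatorics using (_C_)
open import Data.List using (List; upTo; map)
import Data.Nat.ListAction as LA
open import Data.Vec using (Vec; lookup; zipWith; tabulate)
import Data.Vec.Properties as VecP
open import Data.Fin using (Fin)
open import Data.Fin.Subset using (Subset; _∩_; ∣_∣; Empty)
open import Data.Product using (_×_)
open import Relation.Binary.PropositionalEquality using (_≡_; _≢_)
open import Relation.Nullary using (does)

-- Σ_{j=0}^{k} (s choose j);  H(s,k) = log₂ (binomSum s k)
binomSum : ℕ → ℕ → ℕ
binomSum s k = LA.sum (map (s C_) (upTo (suc k)))

-- Deterministic two-party protocol tree.  Alice's input type A, Bob's B,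
-- output O is produced by Alice (a function of her input and the transcript).
data Protocol (A B O : Set) : Set where
  out   : (A → O) → Protocol A B O
  alice : (A → Bool) → (Bool → Protocol A B O) → Protocol A B O
  bob   : (B → Bool) → (Bool → Protocol A B O) → Protocol A B O

run : {A B O : Set} → Protocol A B O → A → B → O
run (out f)     a b = f a
run (alice f k) a b = run (k (f a)) a b
run (bob f k)   a b = run (k (f b)) a b

cost : {A B O : Set} → Protocol A B O → A → B → ℕ
cost (out f)     a b = zero
cost (alice f k) a b = suc (cost (k (f a)) a b)
cost (bob f k)   a b = suc (cost (k (f b)) a b)

diffSet : {n : ℕ} → Vec Bool n → Vec Bool n → Subset n
diffSet x y = zipWith _xor_ x y

AliceIn : ℕ → Set
AliceIn n = Vec Bool n

BobIn : ℕ → ℕ → Set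
BobIn n t = Vec Bool n × (Fin t → Subset n)

Valid : (n t : ℕ) → Vec ℕ t → Vec ℕ t → Vec Bool n → Vec Bool n → (Fin t → Subset n) → Set
Valid n t s k x y S =
  (∀ i j → i ≢ j → Empty (S i ∩ S j)) ×
  (∀ i → ∣ S i ∣ ≡ lookup s i) ×
  (∀ i → ∣ S i ∩ diffSet x y ∣ ≤ lookup k i)

DocProtocol : ℕ → ℕ → Set
DocProtocol n t = Protocol (AliceIn n) (BobIn n t) (Vec Bool n)

-- number of random seeds r : Fin m on which the protocol family outputs y
successes : {n t m : ℕ} → (Fin m → DocProtocol n t) →
            Vec Bool n → Vec Bool n → (Fin t → Subset n) → ℕ
successes {m = m} P x y S =
  ∣ tabulate {n = m} (λ r → does (VecP.≡-dec Bool._≟_ (run (P r) x (y Data.Product., S)) y)) ∣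

module Submission where

-- Fix Alice's input to the all-zero string ⊥ and let Bob hold any y of
-- weight at most K = Σ k together with a block vector 𝒮(y) built for it:
-- a list of n labels contains block i exactly s[i] times, k[i] of them
-- among its first K entries; the 1-positions of y take the first |y|
-- labels, the 0-positions the rest.  This makes (⊥ , y , 𝒮(y)) valid, and
-- the strings y form the Hamming ball of radius K, of size H = Σ_{j≤K} (n C j).
--
-- Leaf counting for protocol trees (Alice's input fixed, Bob's inputs
-- ranging over a duplicate-free list L): if the protocol recovers every
-- member of L, some member costs at least log₂ |L| bits.  Deterministic
-- protocols recover the whole ball, giving H ≤ 2^cost.  For a protocol
-- family correct on at least half of the m seeds on every input, double
-- counting and pigeonhole give a seed r recovering at least half the ball,
-- giving H ≤ 2^(1 + cost).

open import Defs
open import Data.Bool using (Bool)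
open import Data.Nat using (ℕ; suc; _≤_; _*_; _^_)
open import Data.Vec using (Vec; lookup; sum)
open import Data.Fin using (Fin)
open import Data.Fin.Subset using (Subset)
open import Data.Product using (Σ; _×_; _,_)
open import Relation.Binary.PropositionalEquality using (_≡_)

open import Data.Bool using (true; false; _∧_; _xor_; if_then_else_)
import Data.Bool as Bool
open import Data.Fin using (zero; suc)
import Data.Fin as Fin
open import Data.Fin.Subset using (∣_∣; _∩_; ∁; ⊥; Empty; inside; outside)
open import Data.Fin.Subset.Properties using (∣⊥∣≡0; ∣∁p∣≡n∸∣p∣)
open import Data.List using (List; []; _∷_; _++_; length; filter; take; drop; applyUpTo)
import Data.List as List
import Data.List.Properties as ListP
open import Data.List.Membership.Propositional using (_∈_)
open import Data.List.Membership.Propositional.Properties using (∈-filter⁻; ∈-map⁻)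
open import Data.List.Relation.Unary.All using (All; []; _∷_)
import Data.List.Relation.Unary.All as All
import Data.List.Relation.Unary.All.Properties as AllP
import Data.List.Relation.Unary.AllPairs.Properties as AllPairs
open import Data.List.Relation.Unary.Any using (here; there)
open import Data.List.Relation.Unary.Unique.Propositional using (Unique; []; _∷_)
import Data.List.Relation.Unary.Unique.Propositional.Properties as UniqueP
open import Data.Maybe using (Maybe; just; nothing)
import Data.Maybe as Maybe
import Data.Maybe.Properties as MaybeP
open import Data.Nat using (zero; _+_; _∸_; _<_; z≤n; s≤s)
open import Data.Nat.Combinatorics using (_C_; nCk+nC[k+1]≡[n+1]C[k+1])
import Data.Nat.ListAction as ListAction
open import Data.Nat.Properties
open import Algebra.Properties.CommutativeSemigroup +-commutativeSemigroup using (x∙yz≈y∙xz; interchange)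
open import Data.Product using (∃-syntax; proj₁)
open import Data.Vec using ([]; _∷_; zipWith; tabulate)
import Data.Vec as Vec
import Data.Vec.Properties as VecP
open import Function using (_∘_)
open import Level using (Level)
open import Relation.Binary.Definitions using (DecidableEquality)
open import Relation.Binary.PropositionalEquality using (refl; sym; trans; cong; cong₂; subst; subst₂; _≢_; module ≡-Reasoning)
open import Relation.Nullary using (Dec; yes; no; does; ¬_; contradiction)
open import Relation.Unary using (Pred; Decidable)

+-≤-2* : ∀ {a b c} → a ≤ c → b ≤ c → a + b ≤ 2 * c
+-≤-2* {c = c} a≤c b≤c = +-mono-≤ a≤c (≤-trans b≤c (m≤m+n c 0))

half-pos : ∀ a → 0 < 2 * a → 0 < a
half-pos (suc a) _ = s≤s z≤n

unique-constant : ∀ {A : Set} {c : A} {L : List A} → Unique L → All (c ≡_) L → length L ≤ 1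
unique-constant {L = []}     _                 _                 = z≤n
unique-constant {L = _ ∷ []} _                 _                 = s≤s z≤n
unique-constant              ((y≢z ∷ _) ∷ _)   (c≡y ∷ c≡z ∷ _)   = contradiction (trans (sym c≡y) c≡z) y≢z

module LeafCounting {A B O : Set} (_≟_ : DecidableEquality O) (encode : O → B) where

  Recovers : Protocol A B O → A → O → Set
  Recovers T a y = run T a (encode y) ≡ y

  recovers? : (T : Protocol A B O) (a : A) → Decidable (Recovers T a)
  recovers? T a y = run T a (encode y) ≟ y

  recovered : Protocol A B O → A → List O → List O
  recovered T a = filter (recovers? T a)

  side : (B → Bool) → Bool → List O → List O
  side f b = filter (λ y → f (encode y) Bool.≟ b)

  length-sides : ∀ f L → length L ≡ length (side f true L) + length (side f false L)
  length-sides f [] = refl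
  length-sides f (y ∷ L) with f (encode y)
  ... | true  = cong suc (length-sides f L)
  ... | false = trans (cong suc (length-sides f L)) (sym (+-suc _ _))

  -- At a leaf at most
  -- one value is recovered; at a node of Bob the larger side keeps half of L.
  leaf-bound : ∀ T a {L} → Unique L → All (Recovers T a) L → 0 < length L →
               ∃[ y ] y ∈ L × length L ≤ 2 ^ cost T a (encode y)
  leaf-bound (out g) a {y ∷ L} uL rL _ = y , here refl , ≤-trans (unique-constant uL rL) (s≤s z≤n)
  leaf-bound (alice f k) a uL rL pos with leaf-bound (k (f a)) a uL rL pos
  ... | y , y∈L , bound = y , y∈L , ≤-trans bound (m≤m+n _ _)
  leaf-bound (bob f k) a {L} uL rL pos = larger (length (side f false L) ≤? length (side f true L))
    where
    -- Side b of L goes to the subtree k b, which costs one bit less.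
    descend : ∀ b → length L ≤ 2 * length (side f b L) →
              ∃[ y ] y ∈ L × length L ≤ 2 ^ cost (bob f k) a (encode y)
    descend b L≤2ℓ with leaf-bound (k b) a (AllPairs.filter⁺ (λ y → f (encode y) Bool.≟ b) uL)
                          (All.tabulate recovered-on-side) (half-pos _ (<-≤-trans pos L≤2ℓ))
      where
      recovered-on-side : ∀ {y} → y ∈ side f b L → Recovers (k b) a y
      recovered-on-side y∈ with ∈-filter⁻ (λ y → f (encode y) Bool.≟ b) y∈
      ... | y∈L , refl = All.lookup rL y∈L
    ... | y , y∈side , bound with ∈-filter⁻ (λ y → f (encode y) Bool.≟ b) y∈side
    ...   | y∈L , refl = y , y∈L , ≤-trans L≤2ℓ (*-monoʳ-≤ 2 bound)

    larger : Dec (length (side f false L) ≤ length (side f true L)) →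
             ∃[ y ] y ∈ L × length L ≤ 2 ^ cost (bob f k) a (encode y)
    larger (yes f≤t) = descend true (begin
      length L                                         ≡⟨ length-sides f L ⟩
      length (side f true L) + length (side f false L) ≤⟨ +-≤-2* ≤-refl f≤t ⟩
      2 * length (side f true L)                       ∎)
      where open ≤-Reasoning
    larger (no f≰t)  = descend false (begin
      length L                                         ≡⟨ length-sides f L ⟩
      length (side f true L) + length (side f false L) ≤⟨ +-≤-2* (<⇒≤ (≰⇒> f≰t)) ≤-refl ⟩
      2 * length (side f false L)                      ∎)
      where open ≤-Reasoning

  recovered-bound : ∀ T a {L} → Unique L → 0 < length (recovered T a L) →
                    ∃[ y ] y ∈ L × length (recovered T a L) ≤ 2 ^ cost T a (encode y)
  recovered-bound T a {L} uL pos
    with leaf-bound T a (AllPairs.filter⁺ (recovers? T a) uL) (AllP.all-filter (recovers? T a) L) pos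
  ... | y , y∈ , bound = y , proj₁ (∈-filter⁻ (recovers? T a) y∈) , bound

length-filter-∷ : ∀ {A : Set} {ℓ : Level} {P : Pred A ℓ} (P? : Decidable P) y L →
  length (filter P? (y ∷ L)) ≡ (if does (P? y) then suc (length (filter P? L)) else length (filter P? L))
length-filter-∷ P? y L with does (P? y)
... | true  = refl
... | false = refl

∣tabulate∣+sum : ∀ {m} (f : Fin m → Bool) (g : Fin m → ℕ) →
  ∣ tabulate f ∣ + sum (tabulate g) ≡ sum (tabulate (λ r → if f r then suc (g r) else g r))
∣tabulate∣+sum {zero}  f g = refl
∣tabulate∣+sum {suc m} f g with f zero | ∣tabulate∣+sum (f ∘ suc) (g ∘ suc)
... | true  | ih = cong suc (trans (x∙yz≈y∙xz ∣ tabulate (f ∘ suc) ∣ (g zero) _) (cong (g zero +_) ih))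
... | false | ih = trans (x∙yz≈y∙xz ∣ tabulate (f ∘ suc) ∣ (g zero) _) (cong (g zero +_) ih)

module _ {A : Set} {ℓ : Level} {m : ℕ} {P : Fin m → Pred A ℓ} (P? : ∀ r → Decidable (P r)) where

  double-count : ∀ N c L → (∀ {y} → y ∈ L → N ≤ c * ∣ tabulate (λ r → does (P? r y)) ∣) →
                 N * length L ≤ c * sum (tabulate (λ r → length (filter (P? r) L)))
  double-count N c [] _ = ≤-trans (≤-reflexive (*-zeroʳ N)) z≤n
  double-count N c (y ∷ L) often = begin
    N * suc (length L)                                                ≡⟨ *-suc N (length L) ⟩
    N + N * length L                                                  ≤⟨ +-mono-≤ (often (here refl)) (double-count N c L (often ∘ there)) ⟩
    c * ∣ tabulate (λ r → does (P? r y)) ∣ + c * sum (tabulate hits)   ≡⟨ sym (*-distribˡ-+ c _ _) ⟩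
    c * (∣ tabulate (λ r → does (P? r y)) ∣ + sum (tabulate hits))     ≡⟨ cong (c *_) (∣tabulate∣+sum _ hits) ⟩
    c * sum (tabulate (λ r → if does (P? r y) then suc (hits r) else hits r))
      ≡⟨ cong (λ v → c * sum v) (VecP.tabulate-cong (λ r → sym (length-filter-∷ (P? r) y L))) ⟩
    c * sum (tabulate (λ r → length (filter (P? r) (y ∷ L))))         ∎
    where
    open ≤-Reasoning
    hits : Fin m → ℕ
    hits r = length (filter (P? r) L)

pigeonhole : ∀ m c N (a : Fin (suc m) → ℕ) → suc m * N ≤ c * sum (tabulate a) → ∃[ r ] N ≤ c * a r
pigeonhole m c N a total with N ≤? c * a zero
... | yes N≤ = zero , N≤
pigeonhole zero c N a total | no N≰ =
  contradiction (subst₂ _≤_ (+-identityʳ N) (cong (c *_) (+-identityʳ (a zero))) total) N≰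
pigeonhole (suc m) c N a total | no N≰ with pigeonhole m c N (a ∘ suc) rest
  where
  -- the first number falls short of N, so the others carry the rest
  rest : suc m * N ≤ c * sum (tabulate (a ∘ suc))
  rest = +-cancelˡ-≤ N _ _ (begin
    N + suc m * N                             ≤⟨ total ⟩
    c * (a zero + sum (tabulate (a ∘ suc)))   ≡⟨ *-distribˡ-+ c (a zero) _ ⟩
    c * a zero + c * sum (tabulate (a ∘ suc)) ≤⟨ +-monoˡ-≤ _ (<⇒≤ (≰⇒> N≰)) ⟩
    N + c * sum (tabulate (a ∘ suc))          ∎)
    where open ≤-Reasoning
... | r , N≤ = suc r , N≤

sum-applyUpTo-cong : ∀ {f g : ℕ → ℕ} K → (∀ j → f j ≡ g j) →
  ListAction.sum (applyUpTo f K) ≡ ListAction.sum (applyUpTo g K)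
sum-applyUpTo-cong zero    f≗g = refl
sum-applyUpTo-cong (suc K) f≗g = cong₂ _+_ (f≗g 0) (sum-applyUpTo-cong K (f≗g ∘ suc))

sum-applyUpTo-+ : ∀ (f g : ℕ → ℕ) K →
  ListAction.sum (applyUpTo (λ j → f j + g j) K) ≡ ListAction.sum (applyUpTo f K) + ListAction.sum (applyUpTo g K)
sum-applyUpTo-+ f g zero    = refl
sum-applyUpTo-+ f g (suc K) = trans (cong (f 0 + g 0 +_) (sum-applyUpTo-+ (f ∘ suc) (g ∘ suc) K))
                                    (interchange (f 0) (g 0) _ _)

binomSum-applyUpTo : ∀ n K → binomSum n K ≡ ListAction.sum (applyUpTo (n C_) (suc K))
binomSum-applyUpTo n K = cong ListAction.sum (ListP.map-upTo (n C_) (suc K))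

-- The j = 0 term makes every binomial sum positive.
binomSum-pos : ∀ n K → 1 ≤ binomSum n K
binomSum-pos n K = s≤s z≤n

binomSum-0 : ∀ K → binomSum 0 K ≡ 1
binomSum-0 K = trans (binomSum-applyUpTo 0 K) (cong suc (vanish K))
  where
  vanish : ∀ K → ListAction.sum (applyUpTo (λ j → 0 C suc j) K) ≡ 0
  vanish zero    = refl
  vanish (suc K) = vanish K

-- Pascal's rule summed over j ≤ K + 1.
binomSum-pascal : ∀ n K → binomSum (suc n) (suc K) ≡ binomSum n (suc K) + binomSum n K
binomSum-pascal n K = begin
  binomSum (suc n) (suc K)             ≡⟨ binomSum-applyUpTo (suc n) (suc K) ⟩
  1 + ∑ (λ j → suc n C suc j)          ≡⟨ cong suc (sum-applyUpTo-cong (suc K) (λ j → sym (nCk+nC[k+1]≡[n+1]C[k+1] n j))) ⟩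
  1 + ∑ (λ j → n C j + n C suc j)      ≡⟨ cong suc (sum-applyUpTo-+ (n C_) (λ j → n C suc j) (suc K)) ⟩
  1 + (∑ (n C_) + ∑ (λ j → n C suc j)) ≡⟨ cong suc (+-comm (∑ (n C_)) _) ⟩
  1 + ∑ (λ j → n C suc j) + ∑ (n C_)   ≡⟨ sym (cong₂ _+_ (binomSum-applyUpTo n (suc K)) (binomSum-applyUpTo n K)) ⟩
  binomSum n (suc K) + binomSum n K    ∎
  where
  open ≡-Reasoning
  ∑ : (ℕ → ℕ) → ℕ
  ∑ f = ListAction.sum (applyUpTo f (suc K))

-- The Hamming ball of radius K around the empty set, as an explicit list: a
-- subset of Fin (1 + n) of size ≤ 1 + K either omits 0 and has size ≤ 1 + K
-- on the rest, or contains 0 and has size ≤ K on the rest.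
ball : (n K : ℕ) → List (Subset n)
ball zero    K       = [] ∷ []
ball (suc n) zero    = ⊥ ∷ []
ball (suc n) (suc K) = List.map (outside ∷_) (ball n (suc K)) ++ List.map (inside ∷_) (ball n K)

ball-small : ∀ n K → All (λ p → ∣ p ∣ ≤ K) (ball n K)
ball-small zero    K       = z≤n ∷ []
ball-small (suc n) zero    = ≤-reflexive (∣⊥∣≡0 (suc n)) ∷ []
ball-small (suc n) (suc K) = AllP.++⁺ (AllP.map⁺ (ball-small n (suc K))) (AllP.map⁺ (All.map s≤s (ball-small n K)))

ball-unique : ∀ n K → Unique (ball n K)
ball-unique zero    K       = [] ∷ []
ball-unique (suc n) zero    = [] ∷ []
ball-unique (suc n) (suc K) =
  UniqueP.++⁺ (UniqueP.map⁺ VecP.∷-injectiveʳ (ball-unique n (suc K)))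
              (UniqueP.map⁺ VecP.∷-injectiveʳ (ball-unique n K)) separated
  where
  -- the two halves differ at position 0
  separated : ∀ {p} → ¬ (p ∈ List.map (outside ∷_) (ball n (suc K)) × p ∈ List.map (inside ∷_) (ball n K))
  separated (p∈₀ , p∈₁) with ∈-map⁻ (outside ∷_) p∈₀ | ∈-map⁻ (inside ∷_) p∈₁
  ... | _ , _ , refl | _ , _ , ()

length-ball : ∀ n K → length (ball n K) ≡ binomSum n K
length-ball zero    K       = sym (binomSum-0 K)
length-ball (suc n) zero    = refl
length-ball (suc n) (suc K) = begin
  length (List.map (outside ∷_) (ball n (suc K)) ++ List.map (inside ∷_) (ball n K))
    ≡⟨ ListP.length-++ (List.map (outside ∷_) (ball n (suc K))) ⟩
  length (List.map (outside ∷_) (ball n (suc K))) + length (List.map (inside ∷_) (ball n K))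
    ≡⟨ cong₂ _+_ (ListP.length-map _ (ball n (suc K))) (ListP.length-map _ (ball n K)) ⟩
  length (ball n (suc K)) + length (ball n K)
    ≡⟨ cong₂ _+_ (length-ball n (suc K)) (length-ball n K) ⟩
  binomSum n (suc K) + binomSum n K
    ≡⟨ sym (binomSum-pascal n K) ⟩
  binomSum (suc n) (suc K) ∎
  where open ≡-Reasoning

-- A label is a block index, or nothing for a position outside every block.
Label : ℕ → Set
Label t = Maybe (Fin t)

is? : ∀ {t} (i : Fin t) → Decidable (_≡ just i)
is? i a = MaybeP.≡-dec Fin._≟_ a (just i)

occ : ∀ {t} → Fin t → List (Label t) → ℕ
occ i l = length (filter (is? i) l)

occ-++ : ∀ {t} (i : Fin t) l m → occ i (l ++ m) ≡ occ i l + occ i m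
occ-++ i l m = trans (cong length (ListP.filter-++ (is? i) l m)) (ListP.length-++ (filter (is? i) l))

occ-take-++ : ∀ {t} (i : Fin t) w l m → w ≤ length l → occ i (take w (l ++ m)) ≤ occ i l
occ-take-++ i zero    l       m _ = z≤n
occ-take-++ i (suc w) (a ∷ l) m (s≤s w≤l) with does (is? i a)
... | true  = s≤s (occ-take-++ i w l m w≤l)
... | false = occ-take-++ i w l m w≤l

occ-nothing : ∀ {t} (i : Fin t) c → occ i (List.replicate c nothing) ≡ 0
occ-nothing i zero    = refl
occ-nothing i (suc c) = occ-nothing i c

blocks : ∀ {t} → Vec ℕ t → List (Label t)
blocks []      = []
blocks (c ∷ v) = List.replicate c (just zero) ++ List.map (Maybe.map suc) (blocks v)

length-blocks : ∀ {t} (v : Vec ℕ t) → length (blocks v) ≡ sum v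
length-blocks []      = refl
length-blocks (c ∷ v) = trans (ListP.length-++ (List.replicate c (just zero)))
  (cong₂ _+_ (ListP.length-replicate c) (trans (ListP.length-map _ (blocks v)) (length-blocks v)))

occ-blocks : ∀ {t} (v : Vec ℕ t) i → occ i (blocks v) ≡ lookup v i
occ-blocks (c ∷ v) i = trans (occ-++ i (List.replicate c (just zero)) _) (by-block i)
  where
  here-count : ∀ {t} c → occ {suc t} zero (List.replicate c (just zero)) ≡ c
  here-count zero    = refl
  here-count (suc c) = cong suc (here-count c)
  there-count : ∀ {t} (i : Fin t) c → occ (suc i) (List.replicate c (just zero)) ≡ 0
  there-count i zero    = refl
  there-count i (suc c) = there-count i c
  shifted-zero : ∀ {t} (l : List (Label t)) → occ zero (List.map (Maybe.map suc) l) ≡ 0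
  shifted-zero []             = refl
  shifted-zero (nothing ∷ l)  = shifted-zero l
  shifted-zero (just _ ∷ l)   = shifted-zero l
  shifted : ∀ {t} (i : Fin t) l → occ (suc i) (List.map (Maybe.map suc) l) ≡ occ i l
  shifted i []            = refl
  shifted i (nothing ∷ l) = shifted i l
  shifted i (just j ∷ l) with does (j Fin.≟ i)
  ... | true  = cong suc (shifted i l)
  ... | false = shifted i l
  by-block : ∀ i → occ i (List.replicate c (just zero)) + occ i (List.map (Maybe.map suc) (blocks v)) ≡ lookup (c ∷ v) i
  by-block zero    = trans (cong₂ _+_ (here-count c) (shifted-zero (blocks v))) (+-identityʳ c)
  by-block (suc i) = trans (cong₂ _+_ (there-count i c) (shifted i (blocks v))) (occ-blocks v i)

blockOf : ∀ {t n} → Fin t → Vec (Label t) n → Subset n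
blockOf i = Vec.map (λ a → does (is? i a))

-- Different labels give disjoint blocks: a position carries one label.
blockOf-disjoint : ∀ {t n} (ℓ : Vec (Label t) n) {i j : Fin t} → i ≢ j → Empty (blockOf i ℓ ∩ blockOf j ℓ)
blockOf-disjoint ℓ {i} {j} i≢j (x , x∈) = i≢j (same-label (lookup ℓ x) (begin
  does (is? i (lookup ℓ x)) ∧ does (is? j (lookup ℓ x))     ≡⟨ sym (cong₂ _∧_ (VecP.lookup-map x _ ℓ) (VecP.lookup-map x _ ℓ)) ⟩
  lookup (blockOf i ℓ) x ∧ lookup (blockOf j ℓ) x           ≡⟨ sym (VecP.lookup-zipWith _∧_ x (blockOf i ℓ) (blockOf j ℓ)) ⟩
  lookup (blockOf i ℓ ∩ blockOf j ℓ) x                      ≡⟨ VecP.[]=⇒lookup x∈ ⟩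
  true                                                      ∎))
  where
  open ≡-Reasoning
  same-label : ∀ a → does (is? i a) ∧ does (is? j a) ≡ true → i ≡ j
  same-label a both with is? i a | is? j a
  ... | yes refl | yes a≡j = MaybeP.just-injective a≡j
  ... | yes _    | no _    = contradiction both λ ()
  ... | no _     | _       = contradiction both λ ()

-- Distribute labels along y: the positions in y receive the labels of
-- `ones` in order, the other positions those of `zeros` (nothing once a
-- list is exhausted).
merge : ∀ {t n} → Subset n → List (Label t) → List (Label t) → Vec (Label t) n
merge []            _          _           = []
merge (inside ∷ y)  []         zeros       = nothing ∷ merge y [] zeros
merge (inside ∷ y)  (a ∷ ones) zeros       = a ∷ merge y ones zeros
merge (outside ∷ y) ones       []          = nothing ∷ merge y ones []
merge (outside ∷ y) ones       (a ∷ zeros) = a ∷ merge y ones zeros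

occ-take-[] : ∀ {t} (i : Fin t) w → occ i (take w []) ≡ 0
occ-take-[] i w = cong (occ i) (ListP.take-all w [] z≤n)

occ-merge-inside : ∀ {t n} (i : Fin t) (y : Subset n) ones zeros →
  ∣ blockOf i (merge y ones zeros) ∩ y ∣ ≡ occ i (take ∣ y ∣ ones)
occ-merge-inside i []            ones       zeros       = refl
occ-merge-inside i (inside ∷ y)  []         zeros       = trans (occ-merge-inside i y [] zeros) (occ-take-[] i ∣ y ∣)
occ-merge-inside i (inside ∷ y)  (a ∷ ones) zeros with does (is? i a)
... | true  = cong suc (occ-merge-inside i y ones zeros)
... | false = occ-merge-inside i y ones zeros
occ-merge-inside i (outside ∷ y) ones       []          = occ-merge-inside i y ones []
occ-merge-inside i (outside ∷ y) ones       (a ∷ zeros) with does (is? i a)  -- (b ∧ false) computes only once b is known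
... | true  = occ-merge-inside i y ones zeros
... | false = occ-merge-inside i y ones zeros

occ-merge : ∀ {t n} (i : Fin t) (y : Subset n) ones zeros →
  ∣ blockOf i (merge y ones zeros) ∣ ≡ occ i (take ∣ y ∣ ones) + occ i (take ∣ ∁ y ∣ zeros)
occ-merge i []            ones       zeros       = refl
occ-merge i (inside ∷ y)  []         zeros       = trans (occ-merge i y [] zeros) (cong (_+ occ i (take ∣ ∁ y ∣ zeros)) (occ-take-[] i ∣ y ∣))
occ-merge i (inside ∷ y)  (a ∷ ones) zeros with does (is? i a)
... | true  = cong suc (occ-merge i y ones zeros)
... | false = occ-merge i y ones zeros
occ-merge i (outside ∷ y) ones       []          = trans (occ-merge i y ones []) (cong (occ i (take ∣ y ∣ ones) +_) (occ-take-[] i ∣ ∁ y ∣))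
occ-merge i (outside ∷ y) ones       (a ∷ zeros) with does (is? i a)
... | true  = trans (cong suc (occ-merge i y ones zeros)) (sym (+-suc _ _))
... | false = occ-merge i y ones zeros

sum-∸ : ∀ {t} (s k : Vec ℕ t) → (∀ i → lookup k i ≤ lookup s i) → sum k + sum (zipWith _∸_ s k) ≡ sum s
sum-∸ []      []      _   = refl
sum-∸ (a ∷ s) (b ∷ k) k≤s = trans (interchange b (sum k) (a ∸ b) _)
  (cong₂ _+_ (m+[n∸m]≡n (k≤s zero)) (sum-∸ s k (λ i → k≤s (suc i))))

diffSet-⊥ : ∀ {n} (y : Subset n) → diffSet ⊥ y ≡ y
diffSet-⊥ = VecP.zipWith-identityˡ {f = _xor_} (λ _ → refl)

module Construction (n t : ℕ) (s k : Vec ℕ t) (k≤s : ∀ i → lookup k i ≤ lookup s i) (Σs≤n : sum s ≤ n) where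

  labels : List (Label t)
  labels = blocks k ++ (blocks (zipWith _∸_ s k) ++ List.replicate (n ∸ sum s) nothing)

  length-labels : length labels ≡ n
  length-labels = begin
    length labels
      ≡⟨ ListP.length-++ (blocks k) ⟩
    length (blocks k) + length (blocks (zipWith _∸_ s k) ++ List.replicate (n ∸ sum s) nothing)
      ≡⟨ cong (length (blocks k) +_) (ListP.length-++ (blocks (zipWith _∸_ s k))) ⟩
    length (blocks k) + (length (blocks (zipWith _∸_ s k)) + length (List.replicate (n ∸ sum s) nothing))
      ≡⟨ cong₂ _+_ (length-blocks k) (cong₂ _+_ (length-blocks (zipWith _∸_ s k)) (ListP.length-replicate (n ∸ sum s))) ⟩
    sum k + (sum (zipWith _∸_ s k) + (n ∸ sum s))
      ≡⟨ sym (+-assoc (sum k) _ _) ⟩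
    sum k + sum (zipWith _∸_ s k) + (n ∸ sum s)
      ≡⟨ cong (_+ (n ∸ sum s)) (sum-∸ s k k≤s) ⟩
    sum s + (n ∸ sum s)
      ≡⟨ m+[n∸m]≡n Σs≤n ⟩
    n ∎
    where open ≡-Reasoning

  occ-labels : ∀ i → occ i labels ≡ lookup s i
  occ-labels i = begin
    occ i labels
      ≡⟨ occ-++ i (blocks k) _ ⟩
    occ i (blocks k) + occ i (blocks (zipWith _∸_ s k) ++ List.replicate (n ∸ sum s) nothing)
      ≡⟨ cong (occ i (blocks k) +_) (occ-++ i (blocks (zipWith _∸_ s k)) _) ⟩
    occ i (blocks k) + (occ i (blocks (zipWith _∸_ s k)) + occ i (List.replicate (n ∸ sum s) nothing))
      ≡⟨ cong₂ _+_ (occ-blocks k i) (cong₂ _+_ (occ-blocks (zipWith _∸_ s k) i) (occ-nothing i (n ∸ sum s))) ⟩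
    lookup k i + (lookup (zipWith _∸_ s k) i + 0)
      ≡⟨ cong (lookup k i +_) (trans (+-identityʳ _) (VecP.lookup-zipWith _∸_ i s k)) ⟩
    lookup k i + (lookup s i ∸ lookup k i)
      ≡⟨ m+[n∸m]≡n (k≤s i) ⟩
    lookup s i ∎
    where open ≡-Reasoning

  occ-prefix : ∀ i w → w ≤ sum k → occ i (take w labels) ≤ lookup k i
  occ-prefix i w w≤Σk = ≤-trans (occ-take-++ i w (blocks k) _ (≤-trans w≤Σk (≤-reflexive (sym (length-blocks k)))))
                                (≤-reflexive (occ-blocks k i))

  blocksFor : Subset n → Fin t → Subset n
  blocksFor y i = blockOf i (merge y labels (drop ∣ y ∣ labels))

  size-blocksFor : ∀ y i → ∣ blocksFor y i ∣ ≡ lookup s i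
  size-blocksFor y i = begin
    ∣ blocksFor y i ∣
      ≡⟨ occ-merge i y labels (drop ∣ y ∣ labels) ⟩
    occ i (take ∣ y ∣ labels) + occ i (take ∣ ∁ y ∣ (drop ∣ y ∣ labels))
      ≡⟨ cong (λ l → occ i (take ∣ y ∣ labels) + occ i l) (ListP.take-all ∣ ∁ y ∣ (drop ∣ y ∣ labels) rest-fits) ⟩
    occ i (take ∣ y ∣ labels) + occ i (drop ∣ y ∣ labels)
      ≡⟨ sym (occ-++ i (take ∣ y ∣ labels) _) ⟩
    occ i (take ∣ y ∣ labels ++ drop (∣ y ∣) labels)
      ≡⟨ cong (occ i) (ListP.take++drop≡id ∣ y ∣ labels) ⟩
    occ i labels
      ≡⟨ occ-labels i ⟩
    lookup s i ∎
    where
    open ≡-Reasoning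
    -- the labels left for the 0-positions exactly fill them
    rest-fits : length (drop ∣ y ∣ labels) ≤ ∣ ∁ y ∣
    rest-fits = ≤-reflexive (trans (ListP.length-drop ∣ y ∣ labels)
                                   (trans (cong (_∸ ∣ y ∣) length-labels) (sym (∣∁p∣≡n∸∣p∣ y))))

  blocksFor-valid : ∀ y → ∣ y ∣ ≤ sum k → Valid n t s k ⊥ y (blocksFor y)
  blocksFor-valid y small =
      (λ i j i≢j → blockOf-disjoint (merge y labels (drop ∣ y ∣ labels)) i≢j)
    , size-blocksFor y
    , λ i → begin
        ∣ blocksFor y i ∩ diffSet ⊥ y ∣  ≡⟨ cong (λ d → ∣ blocksFor y i ∩ d ∣) (diffSet-⊥ y) ⟩
        ∣ blocksFor y i ∩ y ∣            ≡⟨ occ-merge-inside i y labels (drop ∣ y ∣ labels) ⟩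
        occ i (take ∣ y ∣ labels)        ≤⟨ occ-prefix i ∣ y ∣ small ⟩
        lookup k i                       ∎
    where open ≤-Reasoning

module LowerBound (n t : ℕ) (s k : Vec ℕ t) (k≤s : ∀ i → lookup k i ≤ lookup s i) (Σs≤n : sum s ≤ n) where

  open Construction n t s k k≤s Σs≤n
  open LeafCounting {AliceIn n} {BobIn n t} (VecP.≡-dec Bool._≟_) (λ y → y , blocksFor y)

  candidates : List (Subset n)
  candidates = ball n (sum k)

  candidate-valid : ∀ {y} → y ∈ candidates → Valid n t s k ⊥ y (blocksFor y)
  candidate-valid y∈ = blocksFor-valid _ (All.lookup (ball-small n (sum k)) y∈)

  length-candidates : length candidates ≡ binomSum n (sum k)
  length-candidates = length-ball n (sum k)

  recovers-all : (P : DocProtocol n t) → (∀ x y S → Valid n t s k x y S → run P x (y , S) ≡ y) →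
                 length (recovered P ⊥ candidates) ≡ binomSum n (sum k)
  recovers-all P correct =
    trans (cong length (ListP.filter-all (recovers? P ⊥) (All.tabulate (λ y∈ → correct _ _ _ (candidate-valid y∈)))))
          length-candidates

  deterministic : (P : DocProtocol n t) →
    (∀ x y S → Valid n t s k x y S → run P x (y , S) ≡ y) →
    Σ (Vec Bool n) λ x → Σ (Vec Bool n) λ y → Σ (Fin t → Subset n) λ S →
      Valid n t s k x y S × binomSum n (sum k) ≤ 2 ^ cost P x (y , S)
  deterministic P correct
    with recovered-bound P ⊥ (ball-unique n (sum k)) (subst (0 <_) (sym (recovers-all P correct)) (binomSum-pos n (sum k)))
  ... | y , y∈ , bound = ⊥ , y , blocksFor y , candidate-valid y∈ , subst (_≤ 2 ^ cost P ⊥ (y , blocksFor y)) (recovers-all P correct) bound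

  randomized : (m : ℕ) → 1 ≤ m → (P : Fin m → DocProtocol n t) →
    (∀ x y S → Valid n t s k x y S → m ≤ 2 * successes P x y S) →
    Σ (Vec Bool n) λ x → Σ (Vec Bool n) λ y → Σ (Fin t → Subset n) λ S → Σ (Fin m) λ r →
      Valid n t s k x y S × binomSum n (sum k) ≤ 2 ^ suc (cost (P r) x (y , S))
  randomized (suc m) _ P often
    with pigeonhole m 2 (length candidates) (λ r → length (recovered (P r) ⊥ candidates))
           (double-count (λ r → recovers? (P r) ⊥) (suc m) 2 candidates (λ y∈ → often _ _ _ (candidate-valid y∈)))
  ... | r , half with recovered-bound (P r) ⊥ (ball-unique n (sum k))
                       (half-pos _ (<-≤-trans (subst (0 <_) (sym length-candidates) (binomSum-pos n (sum k))) half))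
  ...   | y , y∈ , bound = ⊥ , y , blocksFor y , r , candidate-valid y∈ , (begin
    binomSum n (sum k)                        ≡⟨ sym length-candidates ⟩
    length candidates                         ≤⟨ half ⟩
    2 * length (recovered (P r) ⊥ candidates) ≤⟨ *-monoʳ-≤ 2 bound ⟩
    2 ^ suc (cost (P r) ⊥ (y , blocksFor y))  ∎)
    where open ≤-Reasoning

mainTheorem1 : (n t : ℕ) (s k : Vec ℕ t) →
    (∀ i → lookup k i ≤ lookup s i) → sum s ≤ n →
    ((P : DocProtocol n t) →
      (∀ x y S → Valid n t s k x y S → run P x (y , S) ≡ y) →
      Σ (Vec Bool n) λ x → Σ (Vec Bool n) λ y → Σ (Fin t → Subset n) λ S →
        Valid n t s k x y S × binomSum n (sum k) ≤ 2 ^ cost P x (y , S))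
    ×
    ((m : ℕ) → 1 ≤ m → (P : Fin m → DocProtocol n t) →
      (∀ x y S → Valid n t s k x y S → m ≤ 2 * successes P x y S) →
      Σ (Vec Bool n) λ x → Σ (Vec Bool n) λ y → Σ (Fin t → Subset n) λ S → Σ (Fin m) λ r →
        Valid n t s k x y S × binomSum n (sum k) ≤ 2 ^ suc (cost (P r) x (y , S)))
mainTheorem1 n t s k k≤s Σs≤n = deterministic , randomized
  where open LowerBound n t s k k≤s Σs≤n
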